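{- Suppose every tournament whose edges are colored with $3$ colors contains a set $S$ of $3$ vertices such that every vertex not in $S$ can be reached by a monochromatic directed path starting in $S$. Then $p(3)=3$, i.e. every $3$-transitive tournament $T$ has $dom(T)\le3$, and some $3$-transitive tournament has $dom(T)=3$.
   Context: A tournament is $3$-transitive if its edges can be colored with $3$ colors so that for each color the digraph of edges of that color is transitive (whenever $ab,bc$ have that color, $ac$ is an edge of that color). $dom(T)$ is the minimum size of a vertex set $D$ such that every $v\notin D$ has some $w\in D$ with $wv\in E(T)$. $p(3)$ is the maximum of $dom(T)$ over all $3$-transitive tournaments. -}

module Defs where

open import Data.Nat using (ℕ; _≤_; _≥_)
open import Data.Fin using (Fin)
open import Data.Fin.Subset using (Subset; _∈_; _∉_; ∣_∣)
open import Data.Bool using (Bool; true; false)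
open import Data.Product using (Σ; ∃; _×_; _,_)
open import Relation.Binary.PropositionalEquality using (_≡_; _≢_)
open import Data.Sum using (_⊎_)

Digraph : ℕ → Set
Digraph n = Fin n → Fin n → Bool

record IsTournament {n : ℕ} (E : Digraph n) : Set where
  field
    irrefl   : ∀ i → E i i ≡ false
    total    : ∀ i j → i ≢ j → E i j ≡ true ⊎ E j i ≡ true
    antisym  : ∀ i j → E i j ≡ true → E j i ≡ false

-- An edge-colouring with k colours (only its values on edges matter).
Colouring : ℕ → ℕ → Set
Colouring n k = Fin n → Fin n → Fin k

data MonoPath {n k : ℕ} (E : Digraph n) (c : Colouring n k) (κ : Fin k)
       : Fin n → Fin n → Set where
  edge : ∀ {u v} → E u v ≡ true → c u v ≡ κ → MonoPath E c κ u v
  step : ∀ {u w v} → E u w ≡ true → c u w ≡ κ → MonoPath E c κ w v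
       → MonoPath E c κ u v

TransitiveColour : ∀ {n k} → Digraph n → Colouring n k → Fin k → Set
TransitiveColour E c κ = ∀ a b d → E a b ≡ true → c a b ≡ κ → E b d ≡ true → c b d ≡ κ
  → (E a d ≡ true) × (c a d ≡ κ)

KTransitive : ℕ → ∀ {n} → Digraph n → Set
KTransitive k {n} E = Σ (Colouring n k) λ c → ∀ κ → TransitiveColour E c κ

Dominating : ∀ {n} → Digraph n → Subset n → Set
Dominating E D = ∀ v → v ∉ D → ∃ λ w → w ∈ D × E w v ≡ true

DomLe : ∀ {n} → Digraph n → ℕ → Set
DomLe E m = ∃ λ D → Dominating E D × ∣ D ∣ ≤ m

DomEq : ∀ {n} → Digraph n → ℕ → Set
DomEq E m = DomLe E m × (∀ D → Dominating E D → ∣ D ∣ ≥ m)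

MonoReach3 : Set
MonoReach3 = ∀ n (E : Digraph n) → IsTournament E → (c : Colouring n 3)
  → ∃ λ (S : Subset n) → ∣ S ∣ ≤ 3
     × (∀ v → v ∉ S → ∃ λ s → s ∈ S × ∃ λ κ → MonoPath E c κ s v)

-- In a transitive colour class a monochromatic path collapses to a single edge of
-- that colour, so the set S given by the hypothesis is already a dominating set of
-- any 3-transitive tournament.  The bound is attained by the Paley tournament on
-- Z/7 (i → j iff j − i is a nonzero square), which is 3-transitive and has no
-- dominating set of two vertices; both facts are checked by exhaustive decision.
module Submission where

open import Defs
open import Data.Bool using (Bool; true; false) renaming (_≟_ to _≟ᵇ_)
open import Data.Fin using (Fin; toℕ; _≟_; #_)
open import Data.Fin.Properties using (all?; any?)
open import Data.Fin.Subset using (Subset; _∈_; _∉_; ∣_∣)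
open import Data.Fin.Subset.Properties using (_∈?_; anySubset?)
open import Data.Nat using (ℕ; _+_; _∸_; _≤_; _<_; _≥_; _<?_; _%_)
open import Data.Nat.Properties using (≮⇒≥)
open import Data.Product using (∃; _×_; _,_; proj₁)
open import Data.Sum using (_⊎_)
open import Data.Vec using (Vec; []; _∷_; lookup)
open import Relation.Nullary using (¬_; Dec; ¬?)
open import Relation.Nullary.Decidable using (_×-dec_; _⊎-dec_; _→-dec_; from-yes; from-no)
open import Relation.Binary.PropositionalEquality using (_≡_; _≢_)

module _ {n k : ℕ} (E : Digraph n) (c : Colouring n k) where

  monoPath⇒edge : ∀ {κ} → TransitiveColour E c κ
    → ∀ {u v} → MonoPath E c κ u v → (E u v ≡ true) × (c u v ≡ κ)
  monoPath⇒edge tr (edge e ce) = e , ce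
  monoPath⇒edge tr (step {u} {w} {v} e ce p) =
    let e′ , ce′ = monoPath⇒edge tr p in tr u w v e ce e′ ce′

  transitiveColour? : ∀ κ → Dec (TransitiveColour E c κ)
  transitiveColour? κ = all? λ a → all? λ b → all? λ d →
    (E a b ≟ᵇ true) →-dec (c a b ≟ κ) →-dec (E b d ≟ᵇ true) →-dec (c b d ≟ κ)
      →-dec ((E a d ≟ᵇ true) ×-dec (c a d ≟ κ))

module _ {n : ℕ} (E : Digraph n) where

  dominating? : ∀ D → Dec (Dominating E D)
  dominating? D = all? λ v → ¬? (v ∈? D) →-dec any? λ w → (w ∈? D) ×-dec (E w v ≟ᵇ true)

  dominatingLowerBound : ∀ m → ¬ ∃ (λ D → ∣ D ∣ < m × Dominating E D)
    → ∀ D → Dominating E D → ∣ D ∣ ≥ m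
  dominatingLowerBound m noSmall D dom = ≮⇒≥ λ small → noSmall (D , small , dom)

  irreflexive? : Dec (∀ i → E i i ≡ false)
  irreflexive? = all? λ i → E i i ≟ᵇ false

  total? : Dec (∀ i j → i ≢ j → E i j ≡ true ⊎ E j i ≡ true)
  total? = all? λ i → all? λ j → ¬? (i ≟ j) →-dec ((E i j ≟ᵇ true) ⊎-dec (E j i ≟ᵇ true))

  antisymmetric? : Dec (∀ i j → E i j ≡ true → E j i ≡ false)
  antisymmetric? = all? λ i → all? λ j → (E i j ≟ᵇ true) →-dec (E j i ≟ᵇ false)

monoReach⇒domLe : ∀ {n k m} (E : Digraph n) (c : Colouring n k)
  → (∀ κ → TransitiveColour E c κ)
  → (S : Subset n) → ∣ S ∣ ≤ m → (∀ v → v ∉ S → ∃ λ s → s ∈ S × ∃ λ κ → MonoPath E c κ s v)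
  → DomLe E m
monoReach⇒domLe E c tr S size reach = S , dominating , size
  where
  dominating : Dominating E S
  dominating v v∉S with reach v v∉S
  ... | s , s∈S , κ , path = s , s∈S , proj₁ (monoPath⇒edge E c (tr κ) path)

kTransitive3⇒domLe3 : MonoReach3
  → (n : ℕ) (E : Digraph n) → IsTournament E → KTransitive 3 E → DomLe E 3
kTransitive3⇒domLe3 reach n E tournament (c , tr) =
  let S , size , reachS = reach n E tournament c in monoReach⇒domLe E c tr S size reachS

nonzeroSquareMod7 : ℕ → Bool
nonzeroSquareMod7 1 = true
nonzeroSquareMod7 2 = true
nonzeroSquareMod7 4 = true
nonzeroSquareMod7 _ = false

paley7 : Digraph 7
paley7 i j = nonzeroSquareMod7 ((toℕ j + 7 ∸ toℕ i) % 7)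

-- Entries on non-edges are irrelevant and set to 0.
paley7Colours : Vec (Vec (Fin 3) 7) 7
paley7Colours =
  (# 0 ∷ # 0 ∷ # 0 ∷ # 0 ∷ # 0 ∷ # 0 ∷ # 0 ∷ []) ∷
  (# 0 ∷ # 0 ∷ # 0 ∷ # 1 ∷ # 0 ∷ # 2 ∷ # 0 ∷ []) ∷
  (# 0 ∷ # 0 ∷ # 0 ∷ # 1 ∷ # 1 ∷ # 0 ∷ # 2 ∷ []) ∷
  (# 2 ∷ # 0 ∷ # 0 ∷ # 0 ∷ # 0 ∷ # 2 ∷ # 0 ∷ []) ∷
  (# 0 ∷ # 2 ∷ # 0 ∷ # 0 ∷ # 0 ∷ # 2 ∷ # 2 ∷ []) ∷
  (# 1 ∷ # 0 ∷ # 0 ∷ # 0 ∷ # 0 ∷ # 0 ∷ # 0 ∷ []) ∷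
  (# 1 ∷ # 1 ∷ # 0 ∷ # 1 ∷ # 0 ∷ # 0 ∷ # 0 ∷ []) ∷ []

paley7Colouring : Colouring 7 3
paley7Colouring i j = lookup (lookup paley7Colours i) j

paley7-isTournament : IsTournament paley7
paley7-isTournament = record
  { irrefl  = from-yes (irreflexive? paley7)
  ; total   = from-yes (total? paley7)
  ; antisym = from-yes (antisymmetric? paley7)
  }

paley7-3Transitive : KTransitive 3 paley7
paley7-3Transitive = paley7Colouring , from-yes (all? (transitiveColour? paley7 paley7Colouring))

paley7-noSmallDominating : ¬ ∃ (λ D → ∣ D ∣ < 3 × Dominating paley7 D)
paley7-noSmallDominating = from-no (anySubset? λ D → (∣ D ∣ <? 3) ×-dec dominating? paley7 D)

corollary1p12 : MonoReach3
    → ((n : ℕ) (E : Digraph n) → IsTournament E → KTransitive 3 E → DomLe E 3)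
    × (∃ λ (n : ℕ) → ∃ λ (E : Digraph n) → IsTournament E × KTransitive 3 E × DomEq E 3)
corollary1p12 reach =
  kTransitive3⇒domLe3 reach ,
  7 , paley7 , paley7-isTournament , paley7-3Transitive ,
  kTransitive3⇒domLe3 reach 7 paley7 paley7-isTournament paley7-3Transitive ,
  dominatingLowerBound paley7 3 paley7-noSmallDominating
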